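{- Let $m\ge 2$ and let $L_m$ and $U_m$ be the lower and upper bar state matrices of length $m$ (defined in the context). Define $A_1=\begin{bmatrix}0&1\end{bmatrix}$, $A_2=\begin{bmatrix}1&0&0&1\\0&1&0&0\end{bmatrix}$ and, for $k\ge 3$, $$A_k=\begin{bmatrix}\begin{bmatrix}A_{k-2}&\mathbb{O}\\ \mathbb{O}&\mathbb{O}\end{bmatrix} & A_{k-1}\\ A_{k-1} & \mathbb{O}\end{bmatrix}.$$ Then $$L_m=\begin{bmatrix}\begin{bmatrix}A_{m-2}&\mathbb{O}\\ \mathbb{O}&\mathbb{O}\end{bmatrix} & A_{m-1}\end{bmatrix},$$ where for $m=2$ the block $\begin{bmatrix}A_{0}&\mathbb{O}\\ \mathbb{O}&\mathbb{O}\end{bmatrix}$ is to be read as $\begin{bmatrix}1&0\end{bmatrix}$. Furthermore $U_m=(L_m)^t$.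
   Context: Consider four mosaic tiles $T_1,T_2,T_3,T_4$, each a unit square whose four edges are labeled by letters a or b, with exactly one edge labeled b: in $T_1$ the left edge, in $T_2$ the top edge, in $T_3$ the bottom edge, in $T_4$ the right edge (all other edges labeled a). A bar mosaic of length $m$ is a horizontal row of $m$ unit squares each carrying one of these tiles; it is suitably adjacent if any two adjacent tiles give the same label to their common edge. Its $l$-state and $r$-state are the labels of its left and right boundary edges; its $b$-state ($t$-state) is the word of length $m$ in $\{\mathrm{a},\mathrm{b}\}$ formed by the labels of its bottom (top) edges read from right to left (so the first letter belongs to the rightmost tile and the last to the leftmost tile). The $2^r$ words of length $r$ in $\{\mathrm{a},\mathrm{b}\}$ are ordered lexicographically with $\mathrm{a}<\mathrm{b}$; $\epsilon^r_i$ denotes the $i$th one. For states $s_r,s_b,s_t$ let $\mu_{\langle s_r,s_b,s_t\rangle}$ be the number of suitably adjacent bar mosaics with $l$-state a, $r$-state $s_r$, $b$-state $s_b$ and $t$-state $s_t$. The lower bar state matrix $L_m$ is the $2^{m-2}\times 2^m$ matrix whose $(i,j)$-entry is $\mu_{\langle \mathrm{a},\,\mathrm{a}\epsilon^{m-2}_i\mathrm{a},\,\epsilon^m_j\rangle}$ (the word $\mathrm{a}\epsilon^{m-2}_i\mathrm{a}$ being the concatenation). The upper bar state matrix $U_m$ is the $2^m\times 2^{m-2}$ matrix whose $(i,j)$-entry is $\mu_{\langle \mathrm{a},\,\epsilon^m_i,\,\mathrm{a}\epsilon^{m-2}_j\mathrm{a}\rangle}$. $\mathbb{O}$ denotes a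 zero matrix of the appropriate size, and $X^t$ the transpose. -}

module Defs where

open import Data.Nat using (ℕ; zero; suc; _+_)
open import Data.Bool using (Bool; true; false; _∧_; if_then_else_)
open import Data.List using (List; []; _∷_; map; concatMap)
open import Data.Nat.ListAction using (sum)
open import Data.Vec using (Vec; []; _∷_; _∷ʳ_; reverse) renaming (map to vmap)

data Letter : Set where
  a b : Letter

-- A matrix of size 2^r × 2^c is represented
-- as a function Word r → Word c → ℕ: the i-th row/column index ε_i is the
-- i-th word in lexicographic order (a < b), so the first letter of the word
-- is the most significant "bit".  In particular a block column split [X Y]
-- corresponds to the first letter being a (X) or b (Y).
Word : ℕ → Set
Word n = Vec Letter n

Matrix : ℕ → ℕ → Set
Matrix r c = Word r → Word c → ℕ

_==ᴸ_ : Letter → Letter → Bool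
a ==ᴸ a = true
b ==ᴸ b = true
_ ==ᴸ _ = false

_==ᵂ_ : ∀ {n} → Word n → Word n → Bool
[] ==ᵂ [] = true
(x ∷ xs) ==ᵂ (y ∷ ys) = (x ==ᴸ y) ∧ (xs ==ᵂ ys)

data Tile : Set where
  T₁ T₂ T₃ T₄ : Tile

allTiles : List Tile
allTiles = T₁ ∷ T₂ ∷ T₃ ∷ T₄ ∷ []

leftE rightE topE bottomE : Tile → Letter
leftE T₁ = b
leftE _  = a
topE T₂ = b
topE _  = a
bottomE T₃ = b
bottomE _  = a
rightE T₄ = b
rightE _  = a

-- A bar mosaic of length m: tiles listed from left to right.
BarMosaic : ℕ → Set
BarMosaic m = Vec Tile m

allMosaics : (m : ℕ) → List (BarMosaic m)
allMosaics zero = [] ∷ []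
allMosaics (suc m) = concatMap (λ t → map (t ∷_) (allMosaics m)) allTiles

suitablyAdjacent : ∀ {m} → BarMosaic m → Bool
suitablyAdjacent [] = true
suitablyAdjacent (t ∷ []) = true
suitablyAdjacent (t ∷ t′ ∷ ts) = (rightE t ==ᴸ leftE t′) ∧ suitablyAdjacent (t′ ∷ ts)

lState : ∀ {m} → BarMosaic (suc m) → Letter
lState (t ∷ _) = leftE t

rState : ∀ {m} → BarMosaic (suc m) → Letter
rState (t ∷ []) = rightE t
rState (_ ∷ t ∷ ts) = rState (t ∷ ts)

bState tState : ∀ {m} → BarMosaic m → Word m
bState M = reverse (vmap bottomE M)
tState M = reverse (vmap topE M)

μ : (k : ℕ) → Letter → Word (suc k) → Word (suc k) → ℕ
μ k sr sb st = sum (map (λ M → if suitablyAdjacent M ∧ (lState M ==ᴸ a) ∧ (rState M ==ᴸ sr)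
                                     ∧ (bState M ==ᵂ sb) ∧ (tState M ==ᵂ st)
                                  then 1 else 0)
                        (allMosaics (suc k)))

-- Lower / upper bar state matrices L_m, U_m for m = n + 2.
Lmat : (n : ℕ) → Matrix n (suc (suc n))
Lmat n i j = μ (suc n) a (a ∷ (i ∷ʳ a)) j

Umat : (n : ℕ) → Matrix (suc (suc n)) n
Umat n i j = μ (suc n) a i (a ∷ (j ∷ʳ a))

-- [[X, O], [O, O]] for X : 2^r × 2^c, giving 2^(r+1) × 2^(c+1).
pad : ∀ {r c} → Matrix r c → Matrix (suc r) (suc c)
pad X (a ∷ i) (a ∷ j) = X i j
pad X _ _ = 0

-- A n is the paper's A_{n+1}  (size 2^n × 2^(n+1)).
A : (n : ℕ) → Matrix n (suc n)
A zero [] (a ∷ []) = 0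
A zero [] (b ∷ []) = 1
A (suc zero) (a ∷ []) (a ∷ a ∷ []) = 1
A (suc zero) (a ∷ []) (b ∷ b ∷ []) = 1
A (suc zero) (b ∷ []) (a ∷ b ∷ []) = 1
A (suc zero) _ _ = 0
-- A_k = [[pad A_{k-2}, A_{k-1}], [A_{k-1}, O]]  (k = n + 3)
A (suc (suc n)) (a ∷ i) (a ∷ j) = pad (A n) i j
A (suc (suc n)) (a ∷ i) (b ∷ j) = A (suc n) i j
A (suc (suc n)) (b ∷ i) (a ∷ j) = A (suc n) i j
A (suc (suc n)) (b ∷ i) (b ∷ j) = 0

-- The left block of L_m: pad A_{m-2}, read as [1 0] when m = 2.
leftBlock : (n : ℕ) → Matrix n (suc n)
leftBlock zero [] (a ∷ []) = 1
leftBlock zero [] (b ∷ []) = 0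
leftBlock (suc n) = pad (A n)

Lclaimed : (n : ℕ) → Matrix n (suc (suc n))
Lclaimed n i (a ∷ j) = leftBlock n i j
Lclaimed n i (b ∷ j) = A n i j

-- A bar mosaic is read tile by tile as a walk on the boundary labels: a tile with left label s,
-- bottom x and top y exists for at most one right label, so the number of suitably adjacent bar
-- mosaics with given boundary and words is a product of 0/1 transfer steps.  Mirroring a bar
-- (T₁ ↔ T₄) shows that the same step table also reads it from right to left, which is how the
-- b- and t-states are written; unfolding the step on the rightmost tile reproduces the
-- recursion defining A_k.  Exchanging top and bottom (T₂ ↔ T₃) makes the count symmetric in the
-- two words, whence U_m = (L_m)ᵗ.
module Submission where

open import Defs
open import Data.Bool using (Bool; true; false; _∧_; if_then_else_)
open import Data.Bool.Properties using (⇔→≡)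
open import Data.Bool.Solver using (module ∨-∧-Solver)
open import Data.List using (List; []; _∷_; map; concatMap)
open import Data.List.Properties using (map-cong; map-∘; map-concatMap)
open import Data.Nat using (ℕ; zero; suc; _+_)
open import Data.Nat.ListAction using (sum)
open import Data.Nat.ListAction.Properties using (sum-++)
open import Data.Nat.Properties using (+-identityʳ)
open import Data.Product using (_×_; _,_)
open import Data.Vec using ([]; _∷_; _∷ʳ_; reverse) renaming (map to vmap)
open import Data.Vec.Properties using (reverse-∷; reverse-involutive)
open import Function.Bundles using (mk⇔)
open import Relation.Binary.PropositionalEquality
  using (_≡_; refl; sym; trans; cong; cong₂; module ≡-Reasoning)

open ≡-Reasoning

==ᴸ-refl : ∀ x → (x ==ᴸ x) ≡ true
==ᴸ-refl a = refl
==ᴸ-refl b = refl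

==ᴸ-sym : ∀ x y → (x ==ᴸ y) ≡ (y ==ᴸ x)
==ᴸ-sym a a = refl
==ᴸ-sym a b = refl
==ᴸ-sym b a = refl
==ᴸ-sym b b = refl

==ᴸ⇒≡ : ∀ {x y} → (x ==ᴸ y) ≡ true → x ≡ y
==ᴸ⇒≡ {a} {a} _ = refl
==ᴸ⇒≡ {b} {b} _ = refl

==ᵂ-refl : ∀ {n} (u : Word n) → (u ==ᵂ u) ≡ true
==ᵂ-refl [] = refl
==ᵂ-refl (x ∷ u) rewrite ==ᴸ-refl x = ==ᵂ-refl u

==ᵂ⇒≡ : ∀ {n} (u v : Word n) → (u ==ᵂ v) ≡ true → u ≡ v
==ᵂ⇒≡ [] [] _ = refl
==ᵂ⇒≡ (x ∷ u) (y ∷ v) eq with x ==ᴸ y in x=y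
... | true = cong₂ _∷_ (==ᴸ⇒≡ x=y) (==ᵂ⇒≡ u v eq)

reverse-==ᵂ : ∀ {n} (u v : Word n) → (reverse u ==ᵂ v) ≡ (u ==ᵂ reverse v)
reverse-==ᵂ u v = ⇔→≡ (mk⇔ to from)
  where
  to : (reverse u ==ᵂ v) ≡ true → (u ==ᵂ reverse v) ≡ true
  to eq rewrite sym (==ᵂ⇒≡ (reverse u) v eq) | reverse-involutive u = ==ᵂ-refl u
  from : (u ==ᵂ reverse v) ≡ true → (reverse u ==ᵂ v) ≡ true
  from eq rewrite ==ᵂ⇒≡ u (reverse v) eq | reverse-involutive v = ==ᵂ-refl v

step : Letter → Letter → Letter → (Letter → ℕ) → ℕ
step a a a k = k b
step a a b k = k a
step a b a k = k a
step a b b k = 0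
step b a a k = k a
step b a b k = 0
step b b a k = 0
step b b b k = 0

fits : Letter → Letter → Letter → Tile → Bool
fits s x y τ = (leftE τ ==ᴸ s) ∧ (bottomE τ ==ᴸ x) ∧ (topE τ ==ᴸ y)

step-tiles : ∀ s x y (k : Letter → ℕ) →
  step s x y k ≡ sum (map (λ τ → if fits s x y τ then k (rightE τ) else 0) allTiles)
step-tiles a a a k = sym (+-identityʳ (k b))
step-tiles a a b k = sym (+-identityʳ (k a))
step-tiles a b a k = sym (+-identityʳ (k a))
step-tiles a b b k = refl
step-tiles b a a k = sym (+-identityʳ (k a))
step-tiles b a b k = refl
step-tiles b b a k = refl
step-tiles b b b k = refl

step-cong : ∀ s x y {k k′ : Letter → ℕ} → (∀ t → k t ≡ k′ t) → step s x y k ≡ step s x y k′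
step-cong a a a eq = eq b
step-cong a a b eq = eq a
step-cong a b a eq = eq a
step-cong a b b eq = refl
step-cong b a a eq = eq a
step-cong b a b eq = refl
step-cong b b a eq = refl
step-cong b b b eq = refl

step-zero : ∀ s x y → step s x y (λ _ → 0) ≡ 0
step-zero a a a = refl
step-zero a a b = refl
step-zero a b a = refl
step-zero a b b = refl
step-zero b a a = refl
step-zero b a b = refl
step-zero b b a = refl
step-zero b b b = refl

step-comm : ∀ s x y s′ x′ y′ (k : Letter → Letter → ℕ) →
  step s x y (λ t → step s′ x′ y′ (k t)) ≡ step s′ x′ y′ (λ t′ → step s x y (λ t → k t t′))
step-comm a a a s′ x′ y′ k = refl
step-comm a a b s′ x′ y′ k = refl
step-comm a b a s′ x′ y′ k = refl
step-comm a b b s′ x′ y′ k = sym (step-zero s′ x′ y′)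
step-comm b a a s′ x′ y′ k = refl
step-comm b a b s′ x′ y′ k = sym (step-zero s′ x′ y′)
step-comm b b a s′ x′ y′ k = sym (step-zero s′ x′ y′)
step-comm b b b s′ x′ y′ k = sym (step-zero s′ x′ y′)

step-swap : ∀ s x y (k : Letter → ℕ) → step s x y k ≡ step s y x k
step-swap a a a k = refl
step-swap a a b k = refl
step-swap a b a k = refl
step-swap a b b k = refl
step-swap b a a k = refl
step-swap b a b k = refl
step-swap b b a k = refl
step-swap b b b k = refl

δ : Letter → Letter → ℕ
δ s t = if s ==ᴸ t then 1 else 0

-- Both sides count the tiles with left label s and right label t.
step-mirror : ∀ s t x y → step s x y (λ u → δ u t) ≡ step t x y (λ u → δ s u)
step-mirror a a a a = refl
step-mirror a a a b = refl
step-mirror a a b a = refl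
step-mirror a a b b = refl
step-mirror a b a a = refl
step-mirror a b a b = refl
step-mirror a b b a = refl
step-mirror a b b b = refl
step-mirror b a a a = refl
step-mirror b a a b = refl
step-mirror b a b a = refl
step-mirror b a b b = refl
step-mirror b b a a = refl
step-mirror b b a b = refl
step-mirror b b b a = refl
step-mirror b b b b = refl

-- barCount s t xs ys: suitably adjacent bars with boundary labels s, t and bottom/top words xs, ys,
-- all read in the same direction starting from the s side.
barCount : ∀ {n} → Letter → Letter → Word n → Word n → ℕ
barCount s t [] [] = δ s t
barCount s t (x ∷ xs) (y ∷ ys) = step s x y (λ u → barCount u t xs ys)

barCount-∷ʳ : ∀ {n} s t (xs ys : Word n) x y →
  barCount s t (xs ∷ʳ x) (ys ∷ʳ y) ≡ step t x y (λ u → barCount s u xs ys)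
barCount-∷ʳ s t [] [] x y = step-mirror s t x y
barCount-∷ʳ s t (x′ ∷ xs) (y′ ∷ ys) x y =
  trans (step-cong s x′ y′ (λ u → barCount-∷ʳ u t xs ys x y))
        (step-comm s x′ y′ t x y (λ u v → barCount u v xs ys))

barCount-reverse : ∀ {n} s t (xs ys : Word n) →
  barCount s t (reverse xs) (reverse ys) ≡ barCount t s xs ys
barCount-reverse s t [] [] = cong (λ c → if c then 1 else 0) (==ᴸ-sym s t)
barCount-reverse s t (x ∷ xs) (y ∷ ys) = begin
  barCount s t (reverse (x ∷ xs)) (reverse (y ∷ ys))
    ≡⟨ cong₂ (barCount s t) (reverse-∷ x xs) (reverse-∷ y ys) ⟩
  barCount s t (reverse xs ∷ʳ x) (reverse ys ∷ʳ y)
    ≡⟨ barCount-∷ʳ s t (reverse xs) (reverse ys) x y ⟩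
  step t x y (λ u → barCount s u (reverse xs) (reverse ys))
    ≡⟨ step-cong t x y (λ u → barCount-reverse s u xs ys) ⟩
  barCount t s (x ∷ xs) (y ∷ ys) ∎

barCount-swap : ∀ {n} s t (xs ys : Word n) → barCount s t xs ys ≡ barCount s t ys xs
barCount-swap s t [] [] = refl
barCount-swap s t (x ∷ xs) (y ∷ ys) =
  trans (step-cong s x y (λ u → barCount-swap u t xs ys)) (step-swap s x y _)

countMosaics : (m : ℕ) → (BarMosaic m → Bool) → ℕ
countMosaics m P = sum (map (λ M → if P M then 1 else 0) (allMosaics m))

sum-map-zero : ∀ {X : Set} (xs : List X) → sum (map (λ _ → 0) xs) ≡ 0
sum-map-zero [] = refl
sum-map-zero (_ ∷ xs) = sum-map-zero xs

sum-concatMap : ∀ {X : Set} (f : X → List ℕ) (xs : List X) →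
  sum (concatMap f xs) ≡ sum (map (λ x → sum (f x)) xs)
sum-concatMap f [] = refl
sum-concatMap f (x ∷ xs) = trans (sum-++ (f x) _) (cong (sum (f x) +_) (sum-concatMap f xs))

countMosaics-cong : ∀ m {P Q : BarMosaic m → Bool} → (∀ M → P M ≡ Q M) →
  countMosaics m P ≡ countMosaics m Q
countMosaics-cong m eq = cong sum (map-cong (λ M → cong (λ c → if c then 1 else 0) (eq M)) (allMosaics m))

countMosaics-∧ : ∀ m c (P : BarMosaic m → Bool) →
  countMosaics m (λ M → c ∧ P M) ≡ (if c then countMosaics m P else 0)
countMosaics-∧ m true P = refl
countMosaics-∧ m false P = sum-map-zero (allMosaics m)

countMosaics-suc : ∀ m (P : BarMosaic (suc m) → Bool) →
  countMosaics (suc m) P ≡ sum (map (λ τ → countMosaics m (λ M → P (τ ∷ M))) allTiles)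
countMosaics-suc m P = begin
  sum (map ind (concatMap (λ τ → map (τ ∷_) (allMosaics m)) allTiles))
    ≡⟨ cong sum (map-concatMap ind (λ τ → map (τ ∷_) (allMosaics m)) allTiles) ⟩
  sum (concatMap (λ τ → map ind (map (τ ∷_) (allMosaics m))) allTiles)
    ≡⟨ sum-concatMap (λ τ → map ind (map (τ ∷_) (allMosaics m))) allTiles ⟩
  sum (map (λ τ → sum (map ind (map (τ ∷_) (allMosaics m)))) allTiles)
    ≡⟨ cong sum (map-cong (λ τ → cong sum (sym (map-∘ {g = ind} {f = τ ∷_} (allMosaics m)))) allTiles) ⟩
  sum (map (λ τ → countMosaics m (λ M → P (τ ∷ M))) allTiles) ∎
  where
  ind : BarMosaic (suc m) → ℕ
  ind M = if P M then 1 else 0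

admissible : ∀ {m} → Letter → Letter → BarMosaic m → Word m → Word m → Bool
admissible s t [] [] [] = s ==ᴸ t
admissible s t (τ ∷ M) (x ∷ xs) (y ∷ ys) = fits s x y τ ∧ admissible (rightE τ) t M xs ys

countMosaics-admissible : ∀ m s t (xs ys : Word m) →
  countMosaics m (λ M → admissible s t M xs ys) ≡ barCount s t xs ys
countMosaics-admissible zero s t [] [] = +-identityʳ (δ s t)
countMosaics-admissible (suc m) s t (x ∷ xs) (y ∷ ys) = begin
  countMosaics (suc m) (λ M → admissible s t M (x ∷ xs) (y ∷ ys))
    ≡⟨ countMosaics-suc m _ ⟩
  sum (map (λ τ → countMosaics m (λ M → fits s x y τ ∧ admissible (rightE τ) t M xs ys)) allTiles)
    ≡⟨ cong sum (map-cong restrict allTiles) ⟩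
  sum (map (λ τ → if fits s x y τ then barCount (rightE τ) t xs ys else 0) allTiles)
    ≡⟨ sym (step-tiles s x y (λ u → barCount u t xs ys)) ⟩
  barCount s t (x ∷ xs) (y ∷ ys) ∎
  where
  restrict : ∀ τ → countMosaics m (λ M → fits s x y τ ∧ admissible (rightE τ) t M xs ys)
                   ≡ (if fits s x y τ then barCount (rightE τ) t xs ys else 0)
  restrict τ = trans (countMosaics-∧ m (fits s x y τ) _)
    (cong (λ n → if fits s x y τ then n else 0) (countMosaics-admissible m (rightE τ) t xs ys))

admissible-correct : ∀ {k} s t (M : BarMosaic (suc k)) (xs ys : Word (suc k)) →
  (suitablyAdjacent M ∧ (lState M ==ᴸ s) ∧ (rState M ==ᴸ t)
    ∧ (vmap bottomE M ==ᵂ xs) ∧ (vmap topE M ==ᵂ ys)) ≡ admissible s t M xs ys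
admissible-correct s t (τ ∷ []) (x ∷ []) (y ∷ []) =
  solve 4 (λ p r u v → con true :* (p :* (r :* ((u :* con true) :* (v :* con true))))
                       := (p :* (u :* v)) :* r)
        refl (leftE τ ==ᴸ s) (rightE τ ==ᴸ t) (bottomE τ ==ᴸ x) (topE τ ==ᴸ y)
  where open ∨-∧-Solver
admissible-correct s t (τ ∷ τ′ ∷ M) (x ∷ xs) (y ∷ ys) = begin
  ((rightE τ ==ᴸ leftE τ′) ∧ adj) ∧ (leftE τ ==ᴸ s) ∧ r ∧ ((bottomE τ ==ᴸ x) ∧ bs) ∧ ((topE τ ==ᴸ y) ∧ ts)
    ≡⟨ reassoc (rightE τ ==ᴸ leftE τ′) adj (leftE τ ==ᴸ s) r (bottomE τ ==ᴸ x) bs (topE τ ==ᴸ y) ts ⟩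
  fits s x y τ ∧ (adj ∧ (rightE τ ==ᴸ leftE τ′) ∧ r ∧ bs ∧ ts)
    ≡⟨ cong (λ c → fits s x y τ ∧ (adj ∧ c ∧ r ∧ bs ∧ ts)) (==ᴸ-sym (rightE τ) (leftE τ′)) ⟩
  fits s x y τ ∧ (adj ∧ (leftE τ′ ==ᴸ rightE τ) ∧ r ∧ bs ∧ ts)
    ≡⟨ cong (fits s x y τ ∧_) (admissible-correct (rightE τ) t (τ′ ∷ M) xs ys) ⟩
  fits s x y τ ∧ admissible (rightE τ) t (τ′ ∷ M) xs ys ∎
  where
  open ∨-∧-Solver
  adj = suitablyAdjacent (τ′ ∷ M)
  r = rState (τ′ ∷ M) ==ᴸ t
  bs = vmap bottomE (τ′ ∷ M) ==ᵂ xs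
  ts = vmap topE (τ′ ∷ M) ==ᵂ ys
  reassoc : ∀ c d p q u v w z →
    ((c ∧ d) ∧ p ∧ q ∧ (u ∧ v) ∧ (w ∧ z)) ≡ ((p ∧ u ∧ w) ∧ (d ∧ c ∧ q ∧ v ∧ z))
  reassoc = solve 8 (λ c d p q u v w z →
    (c :* d) :* (p :* (q :* ((u :* v) :* (w :* z)))) := (p :* (u :* w)) :* (d :* (c :* (q :* (v :* z)))))
    refl

μ≡barCount : ∀ k t (sb st : Word (suc k)) → μ k t sb st ≡ barCount t a sb st
μ≡barCount k t sb st = begin
  μ k t sb st
    ≡⟨ countMosaics-cong (suc k) (λ M → trans
         (cong₂ (λ p q → suitablyAdjacent M ∧ (lState M ==ᴸ a) ∧ (rState M ==ᴸ t) ∧ p ∧ q)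
                (reverse-==ᵂ (vmap bottomE M) sb) (reverse-==ᵂ (vmap topE M) st))
         (admissible-correct a t M (reverse sb) (reverse st))) ⟩
  countMosaics (suc k) (λ M → admissible a t M (reverse sb) (reverse st))
    ≡⟨ countMosaics-admissible (suc k) a t (reverse sb) (reverse st) ⟩
  barCount a t (reverse sb) (reverse st)
    ≡⟨ barCount-reverse a t sb st ⟩
  barCount t a sb st ∎

mutual
  A≡barCount : ∀ n (i : Word n) (j : Word (suc n)) → A n i j ≡ barCount a a (i ∷ʳ a) j
  A≡barCount zero [] (a ∷ []) = refl
  A≡barCount zero [] (b ∷ []) = refl
  A≡barCount (suc zero) (a ∷ []) (a ∷ a ∷ []) = refl
  A≡barCount (suc zero) (a ∷ []) (a ∷ b ∷ []) = refl
  A≡barCount (suc zero) (a ∷ []) (b ∷ a ∷ []) = refl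
  A≡barCount (suc zero) (a ∷ []) (b ∷ b ∷ []) = refl
  A≡barCount (suc zero) (b ∷ []) (a ∷ a ∷ []) = refl
  A≡barCount (suc zero) (b ∷ []) (a ∷ b ∷ []) = refl
  A≡barCount (suc zero) (b ∷ []) (b ∷ a ∷ []) = refl
  A≡barCount (suc zero) (b ∷ []) (b ∷ b ∷ []) = refl
  A≡barCount (suc (suc n)) (a ∷ i) (a ∷ j) = leftBlock≡barCount (suc n) i j
  A≡barCount (suc (suc n)) (a ∷ i) (b ∷ j) = A≡barCount (suc n) i j
  A≡barCount (suc (suc n)) (b ∷ i) (a ∷ j) = A≡barCount (suc n) i j
  A≡barCount (suc (suc n)) (b ∷ i) (b ∷ j) = refl

  leftBlock≡barCount : ∀ n (i : Word n) (j : Word (suc n)) → leftBlock n i j ≡ barCount b a (i ∷ʳ a) j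
  leftBlock≡barCount zero [] (a ∷ []) = refl
  leftBlock≡barCount zero [] (b ∷ []) = refl
  leftBlock≡barCount (suc n) (a ∷ i) (a ∷ j) = A≡barCount n i j
  leftBlock≡barCount (suc n) (a ∷ i) (b ∷ j) = refl
  leftBlock≡barCount (suc n) (b ∷ i) (a ∷ j) = refl
  leftBlock≡barCount (suc n) (b ∷ i) (b ∷ j) = refl

lemma3 : (n : ℕ) →
    ((i : Word n) (j : Word (suc (suc n))) → Lmat n i j ≡ Lclaimed n i j)
    × ((i : Word (suc (suc n))) (j : Word n) → Umat n i j ≡ Lmat n j i)
lemma3 n = Lmat≡Lclaimed , Umat≡Lmatᵗ
  where
  Lmat≡Lclaimed : (i : Word n) (j : Word (suc (suc n))) → Lmat n i j ≡ Lclaimed n i j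
  Lmat≡Lclaimed i (a ∷ j) = trans (μ≡barCount (suc n) a _ _) (sym (leftBlock≡barCount n i j))
  Lmat≡Lclaimed i (b ∷ j) = trans (μ≡barCount (suc n) a _ _) (sym (A≡barCount n i j))

  Umat≡Lmatᵗ : (i : Word (suc (suc n))) (j : Word n) → Umat n i j ≡ Lmat n j i
  Umat≡Lmatᵗ i j = begin
    Umat n i j                      ≡⟨ μ≡barCount (suc n) a i _ ⟩
    barCount a a i (a ∷ (j ∷ʳ a))  ≡⟨ barCount-swap a a i _ ⟩
    barCount a a (a ∷ (j ∷ʳ a)) i  ≡⟨ sym (μ≡barCount (suc n) a _ i) ⟩
    Lmat n j i                      ∎
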